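{- The set $E(K_4)\times E(K_6)$ can be partitioned into $14$ blocks; that is, $g(K_4,K_6)\le 14<(4-1)(6-1)$.
   Context: A complete bipartite subgraph of a graph $G$ is given by two nonempty disjoint vertex sets $X,Y$ of $G$ such that every pair $xy$ with $x\in X,y\in Y$ is an edge of $G$; its edge set is all such pairs. For graphs $G,H$, a block is a set of the form $E(B_1)\times E(B_2)$ where $B_1$ is a complete bipartite subgraph of $G$ and $B_2$ a complete bipartite subgraph of $H$. $g(G,H)$ is the minimum number of blocks needed to partition $E(G)\times E(H)$. $K_m$ denotes the complete graph on $m$ vertices. -}

module Defs where

open import Data.Nat using (ℕ)
open import Data.Fin using (Fin; _<_)
open import Data.Fin.Subset using (Subset; _∈_; _∉_; Nonempty)
open import Data.Product using (Σ; _×_; _,_)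
open import Data.Sum using (_⊎_)
open import Relation.Binary.PropositionalEquality using (_≢_; _≡_)

-- The complete graph K m has vertex set Fin m; u,v adjacent iff u ≢ v.
-- An edge (unordered pair {u,v}, u ≠ v) is represented canonically as (u , v) with u < v.
Edge : ℕ → Set
Edge m = Σ (Fin m) λ u → Σ (Fin m) λ v → u < v

record CompleteBipartite (m : ℕ) : Set where
  field
    X Y       : Subset m
    X-nonempty : Nonempty X
    Y-nonempty : Nonempty Y
    disjoint  : ∀ x → x ∈ X → x ∉ Y
    complete  : ∀ x y → x ∈ X → y ∈ Y → x ≢ y

open CompleteBipartite public

_∈E_ : ∀ {m} → Edge m → CompleteBipartite m → Set
(u , v , _) ∈E B = (u ∈ X B × v ∈ Y B) ⊎ (v ∈ X B × u ∈ Y B)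

Block : ℕ → ℕ → Set
Block m n = CompleteBipartite m × CompleteBipartite n

_∈Block_ : ∀ {m n} → Edge m × Edge n → Block m n → Set
(e , f) ∈Block (B₁ , B₂) = (e ∈E B₁) × (f ∈E B₂)

IsBlockPartition : ∀ {m n} (k : ℕ) → (Fin k → Block m n) → Set
IsBlockPartition {m} {n} k bs =
  ∀ (e : Edge m) (f : Edge n) →
    Σ (Fin k) λ i → ((e , f) ∈Block bs i) × (∀ j → (e , f) ∈Block bs j → j ≡ i)

-- E(K₄) × E(K₆) is partitioned by blocks B₁ × B₂ exactly when, for every
-- edge e of K₄, the factors B₂ of the blocks with e ∈ E(B₁) partition E(K₆);
-- the fourteen blocks below are an explicit such family.
module Submission where

open import Defs
open import Data.Nat using (_<_; _∸_; _*_)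
open import Data.Nat.Properties using (≤-refl)
open import Data.Fin using (Fin; #_) renaming (_<_ to _<ᶠ_)
open import Data.Fin.Properties using (all?; any?; _≟_; _<?_; <-irrelevant)
open import Data.Fin.Subset using (Subset; ⊥; ⁅_⁆; _∪_; _∈_; _∉_)
open import Data.Fin.Subset.Properties using (_∈?_; nonempty?)
open import Data.List using (List; []; _∷_; foldr)
open import Data.Empty using (⊥-elim)
open import Data.Product using (Σ; _×_; _,_)
open import Data.Vec using (Vec; lookup) renaming (_∷_ to _∷ᵛ_; [] to []ᵛ)
open import Relation.Nullary using (Dec; yes; no; ¬?)
open import Relation.Nullary.Decidable
  using (True; toWitness; map′; _×-dec_; _⊎-dec_; _→-dec_)
open import Relation.Binary.PropositionalEquality using (_≡_; _≢_; subst)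

disjoint? : ∀ {m} (X Y : Subset m) → Dec (∀ x → x ∈ X → x ∉ Y)
disjoint? X Y = all? λ x → (x ∈? X) →-dec ¬? (x ∈? Y)

complete? : ∀ {m} (X Y : Subset m) → Dec (∀ x y → x ∈ X → y ∈ Y → x ≢ y)
complete? X Y = all? λ x → all? λ y → (x ∈? X) →-dec ((y ∈? Y) →-dec ¬? (x ≟ y))

_⋈_ : ∀ {m} (X Y : Subset m) →
      {_ : True (nonempty? X)} {_ : True (nonempty? Y)} →
      {_ : True (disjoint? X Y)} {_ : True (complete? X Y)} →
      CompleteBipartite m
(X ⋈ Y) {X≠∅} {Y≠∅} {X∩Y=∅} {X×Y⊆E} = record
  { X = X ; Y = Y
  ; X-nonempty = toWitness X≠∅ ; Y-nonempty = toWitness Y≠∅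
  ; disjoint = toWitness X∩Y=∅ ; complete = toWitness X×Y⊆E }

_∈E?_ : ∀ {m} (e : Edge m) (B : CompleteBipartite m) → Dec (e ∈E B)
(u , v , _) ∈E? B =
  ((u ∈? X B) ×-dec (v ∈? Y B)) ⊎-dec ((v ∈? X B) ×-dec (u ∈? Y B))

_∈Block?_ : ∀ {m n} (ef : Edge m × Edge n) (b : Block m n) → Dec (ef ∈Block b)
(e , f) ∈Block? (B₁ , B₂) = (e ∈E? B₁) ×-dec (f ∈E? B₂)

all-edges? : ∀ {m p} {P : Edge m → Set p} →
             (∀ e → Dec (P e)) → Dec (∀ e → P e)
all-edges? {P = P} P? =
  map′ (λ ∀P (u , v , u<v) → ∀P u v u<v) (λ ∀P u v u<v → ∀P (u , v , u<v))
       (all? λ u → all? λ v → all-proofs? u v)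
  where
  -- the proof of u < v is irrelevant, so one instance decides them all
  all-proofs? : ∀ u v → Dec ((u<v : u <ᶠ v) → P (u , v , u<v))
  all-proofs? u v with u <? v
  ... | no u≮v = yes λ u<v → ⊥-elim (u≮v u<v)
  ... | yes u<v = map′ (λ p u<v′ → subst (λ q → P (u , v , q)) (<-irrelevant u<v u<v′) p)
                       (λ ∀p → ∀p u<v) (P? (u , v , u<v))

exists-unique? : ∀ {k p} {P : Fin k → Set p} → (∀ i → Dec (P i)) →
                 Dec (Σ (Fin k) λ i → P i × (∀ j → P j → j ≡ i))
exists-unique? P? = any? λ i → P? i ×-dec all? λ j → P? j →-dec (j ≟ i)

isBlockPartition? : ∀ {m n k} (bs : Fin k → Block m n) → Dec (IsBlockPartition k bs)
isBlockPartition? bs = all-edges? λ e → all-edges? λ f →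
  exists-unique? λ i → (e , f) ∈Block? bs i

⟦_⟧ : ∀ {n} → List (Fin n) → Subset n
⟦_⟧ = foldr (λ x S → ⁅ x ⁆ ∪ S) ⊥

blocks : Vec (Block 4 6) 14
blocks =
  ((⟦ # 0 ∷ [] ⟧ ⋈ ⟦ # 1 ∷ [] ⟧) , (⟦ # 0 ∷ # 3 ∷ [] ⟧ ⋈ ⟦ # 1 ∷ # 2 ∷ [] ⟧)) ∷ᵛ
  ((⟦ # 0 ∷ [] ⟧ ⋈ ⟦ # 1 ∷ [] ⟧) , (⟦ # 1 ∷ # 3 ∷ # 5 ∷ [] ⟧ ⋈ ⟦ # 4 ∷ [] ⟧)) ∷ᵛ
  ((⟦ # 0 ∷ # 1 ∷ [] ⟧ ⋈ ⟦ # 2 ∷ # 3 ∷ [] ⟧) , (⟦ # 0 ∷ # 4 ∷ [] ⟧ ⋈ ⟦ # 1 ∷ [] ⟧)) ∷ᵛ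
  ((⟦ # 0 ∷ # 1 ∷ [] ⟧ ⋈ ⟦ # 2 ∷ # 3 ∷ [] ⟧) , (⟦ # 1 ∷ # 2 ∷ # 4 ∷ [] ⟧ ⋈ ⟦ # 3 ∷ [] ⟧)) ∷ᵛ
  ((⟦ # 2 ∷ [] ⟧ ⋈ ⟦ # 3 ∷ [] ⟧) , (⟦ # 0 ∷ # 3 ∷ [] ⟧ ⋈ ⟦ # 1 ∷ # 2 ∷ [] ⟧)) ∷ᵛ
  ((⟦ # 2 ∷ [] ⟧ ⋈ ⟦ # 3 ∷ [] ⟧) , (⟦ # 1 ∷ # 3 ∷ # 5 ∷ [] ⟧ ⋈ ⟦ # 4 ∷ [] ⟧)) ∷ᵛ
  ((⟦ # 0 ∷ [] ⟧ ⋈ ⟦ # 2 ∷ [] ⟧) , (⟦ # 0 ∷ # 1 ∷ # 4 ∷ [] ⟧ ⋈ ⟦ # 2 ∷ # 5 ∷ [] ⟧)) ∷ᵛ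
  ((⟦ # 0 ∷ [] ⟧ ⋈ ⟦ # 3 ∷ [] ⟧) , (⟦ # 0 ∷ # 5 ∷ [] ⟧ ⋈ ⟦ # 2 ∷ # 3 ∷ # 4 ∷ [] ⟧)) ∷ᵛ
  ((⟦ # 1 ∷ [] ⟧ ⋈ ⟦ # 2 ∷ [] ⟧) , (⟦ # 0 ∷ # 5 ∷ [] ⟧ ⋈ ⟦ # 2 ∷ # 3 ∷ # 4 ∷ [] ⟧)) ∷ᵛ
  ((⟦ # 1 ∷ [] ⟧ ⋈ ⟦ # 3 ∷ [] ⟧) , (⟦ # 0 ∷ # 1 ∷ # 4 ∷ [] ⟧ ⋈ ⟦ # 2 ∷ # 5 ∷ [] ⟧)) ∷ᵛ
  ((⟦ # 0 ∷ # 3 ∷ [] ⟧ ⋈ ⟦ # 1 ∷ # 2 ∷ [] ⟧) , (⟦ # 0 ∷ [] ⟧ ⋈ ⟦ # 3 ∷ # 4 ∷ [] ⟧)) ∷ᵛ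
  ((⟦ # 0 ∷ # 3 ∷ [] ⟧ ⋈ ⟦ # 1 ∷ # 2 ∷ [] ⟧) , (⟦ # 2 ∷ # 3 ∷ [] ⟧ ⋈ ⟦ # 5 ∷ [] ⟧)) ∷ᵛ
  ((⟦ # 0 ∷ # 2 ∷ [] ⟧ ⋈ ⟦ # 1 ∷ # 3 ∷ [] ⟧) , (⟦ # 0 ∷ # 1 ∷ [] ⟧ ⋈ ⟦ # 5 ∷ [] ⟧)) ∷ᵛ
  ((⟦ # 0 ∷ # 2 ∷ [] ⟧ ⋈ ⟦ # 1 ∷ # 3 ∷ [] ⟧) , (⟦ # 1 ∷ # 4 ∷ [] ⟧ ⋈ ⟦ # 2 ∷ [] ⟧)) ∷ᵛ
  []ᵛ

proposition5 : Σ (Fin 14 → Block 4 6) (λ bs → IsBlockPartition 14 bs)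
    × (14 < (4 ∸ 1) * (6 ∸ 1))
proposition5 = (lookup blocks , blocks-partition) , ≤-refl
  where
  blocks-partition : IsBlockPartition 14 (lookup blocks)
  blocks-partition = toWitness {a? = isBlockPartition? (lookup blocks)} _
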